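{- Let $n$ be a positive integer, $k=\lceil\log_3 n\rceil$, and let $m$ be an integer with $n\le m<3^k<3n$. Suppose that $m=2^r t$, where $r\ge 2$ is an integer and $t\ge 5$ is an odd integer. Then there exist integers $1\le a<b\le n$ such that $b^3+b\equiv a^3+a\pmod{m}$.
   Context: $\lceil x\rceil$ denotes the smallest integer no less than $x$. -}

module Defs where

open import Data.Nat using (ℕ; _≤_; _^_)
open import Data.Product using (_×_)

-- k = ⌈log₃ n⌉ : the smallest natural number k with n ≤ 3^k
-- (for n ≥ 1, this is exactly the least integer no less than log₃ n).
IsCeilLog₃ : ℕ → ℕ → Set
IsCeilLog₃ n k = (n ≤ 3 ^ k) × (∀ j → n ≤ 3 ^ j → k ≤ j)

-- Write f(x) = x³ + x. Then f(a + t) − f(a) = t (3a² + 3at + t² + 1), so for m = 2ʳ t it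
-- suffices to take b = a + t with 1 ≤ a < 2ʳ and 2ʳ ∣ 3a² + 3at + t² + 1. For odd t this
-- quadratic in a is even everywhere and its derivative 6a + 3t is odd, so a root modulo 2
-- lifts, Hensel style, to a root modulo 2ʳ below 2ʳ. Finally b < 2ʳ + t ≤ n follows from
-- 2ʳ t + 2 ≤ 3n because 2ʳ ≥ 4 and t ≥ 5.
module Submission where

module NatFacts where
  open import Data.Nat
  open import Data.Nat.Properties
    using (≤-refl; ≤-reflexive; ≤-trans; <-≤-trans; m≤m+n; n<1+n; *-comm;
           +-monoˡ-≤; +-monoʳ-≤; +-monoˡ-<; *-monoʳ-≤; *-cancelˡ-<; module ≤-Reasoning)
  open import Data.Nat.DivMod using (_/_; _%_; m%n<n; m≡m%n+[m/n]*n)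
  open import Data.Nat.Divisibility using (_∣_; divides)
  open import Data.Nat.Tactic.RingSolver using (solve-∀; solve)
  open import Data.Product using (∃; _×_; _,_)
  open import Data.Sum using (_⊎_; inj₁; inj₂)
  open import Data.List using (_∷_; [])
  open import Relation.Nullary using (¬_; contradiction)
  open import Relation.Binary.PropositionalEquality
    using (_≡_; refl; trans; cong; module ≡-Reasoning)

  even⊎odd : ∀ q → ∃ λ u → q ≡ 2 * u ⊎ q ≡ 1 + 2 * u
  even⊎odd q with q % 2 | m%n<n q 2 | m≡m%n+[m/n]*n q 2
  ... | 0 | _ | q≡ = q / 2 , inj₁ (trans q≡ (*-comm (q / 2) 2))
  ... | 1 | _ | q≡ = q / 2 , inj₂ (trans q≡ (cong suc (*-comm (q / 2) 2)))
  ... | suc (suc _) | s≤s (s≤s ()) | _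

  ¬2∣⇒≡1+2* : ∀ q → ¬ 2 ∣ q → ∃ λ s → q ≡ 1 + 2 * s
  ¬2∣⇒≡1+2* q ¬2∣q with even⊎odd q
  ... | u , inj₁ q≡2u = contradiction (divides u (trans q≡2u (*-comm 2 u))) ¬2∣q
  ... | s , inj₂ q≡1+2s = s , q≡1+2s

  differenceQuotient : ℕ → ℕ → ℕ
  differenceQuotient t a = 3 * a * a + 3 * a * t + t * t + 1

  cube+self-shift : ∀ a t → (a + t) ^ 3 + (a + t) ≡ (a ^ 3 + a) + t * differenceQuotient t a
  cube+self-shift = expand
    where
    expand : ∀ a t → (a + t) * ((a + t) * ((a + t) * 1)) + (a + t)
                     ≡ (a * (a * (a * 1)) + a) + t * (3 * a * a + 3 * a * t + t * t + 1)
    expand = solve-∀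

  differenceQuotient-shift : ∀ t a e →
    differenceQuotient t (a + e) ≡ differenceQuotient t a + e * (6 * a + 3 * t + 3 * e)
  differenceQuotient-shift = expand
    where
    expand : ∀ t a e → 3 * (a + e) * (a + e) + 3 * (a + e) * t + t * t + 1
                     ≡ (3 * a * a + 3 * a * t + t * t + 1) + e * (6 * a + 3 * t + 3 * e)
    expand = solve-∀

  lift-root : ∀ s e a → a < 2 * e → 2 * e ∣ differenceQuotient (1 + 2 * s) a →
    ∃ λ a′ → a ≤ a′ × a′ < 2 * (2 * e) × 2 * (2 * e) ∣ differenceQuotient (1 + 2 * s) a′
  lift-root s e a a<2e (divides q D≡q*2e) with even⊎odd q
  ... | u , inj₁ refl = a , ≤-refl , ≤-trans a<2e (m≤m+n _ _) , divides u D≡u*4e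
    where
    D≡u*4e : differenceQuotient (1 + 2 * s) a ≡ u * (2 * (2 * e))
    D≡u*4e = trans D≡q*2e (solve (u ∷ e ∷ []))
  ... | u , inj₂ refl = a + 2 * e , m≤m+n a _ , a+2e<4e , divides (2 + u + 3 * a + 3 * s + 3 * e) D′≡c*4e
    where
    a+2e<4e : a + 2 * e < 2 * (2 * e)
    a+2e<4e = <-≤-trans (+-monoˡ-< (2 * e) a<2e) (≤-reflexive 2e+2e≡4e)
      where
      2e+2e≡4e : 2 * e + 2 * e ≡ 2 * (2 * e)
      2e+2e≡4e = solve (e ∷ [])
    D′≡c*4e : differenceQuotient (1 + 2 * s) (a + 2 * e) ≡ (2 + u + 3 * a + 3 * s + 3 * e) * (2 * (2 * e))
    D′≡c*4e = begin
      differenceQuotient (1 + 2 * s) (a + 2 * e)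
        ≡⟨ differenceQuotient-shift (1 + 2 * s) a (2 * e) ⟩
      differenceQuotient (1 + 2 * s) a + 2 * e * (6 * a + 3 * (1 + 2 * s) + 3 * (2 * e))
        ≡⟨ cong (_+ 2 * e * (6 * a + 3 * (1 + 2 * s) + 3 * (2 * e))) D≡q*2e ⟩
      (1 + 2 * u) * (2 * e) + 2 * e * (6 * a + 3 * (1 + 2 * s) + 3 * (2 * e))
        ≡⟨ solve (u ∷ e ∷ a ∷ s ∷ []) ⟩
      (2 + u + 3 * a + 3 * s + 3 * e) * (2 * (2 * e)) ∎
      where open ≡-Reasoning

  root-mod-2^ : ∀ s j → ∃ λ a → 1 ≤ a × a < 2 ^ suc j × 2 ^ suc j ∣ differenceQuotient (1 + 2 * s) a
  root-mod-2^ s zero = 1 , ≤-refl , s≤s (s≤s z≤n) , divides (2 * s * s + 5 * s + 4) (expand s)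
    where
    expand : ∀ s → 3 * 1 * 1 + 3 * 1 * (1 + 2 * s) + (1 + 2 * s) * (1 + 2 * s) + 1
                   ≡ (2 * s * s + 5 * s + 4) * 2 ^ 1
    expand = solve-∀
  root-mod-2^ s (suc j) =
    let a , 1≤a , a<2ʲ⁺¹ , 2ʲ⁺¹∣D = root-mod-2^ s j
        a′ , a≤a′ , a′<2ʲ⁺² , 2ʲ⁺²∣D′ = lift-root s (2 ^ j) a a<2ʲ⁺¹ 2ʲ⁺¹∣D
    in a′ , ≤-trans 1≤a a≤a′ , a′<2ʲ⁺² , 2ʲ⁺²∣D′

  odd⇒root-mod-2^ : ∀ {t r} → ¬ 2 ∣ t → 1 ≤ r →
    ∃ λ a → 1 ≤ a × a < 2 ^ r × 2 ^ r ∣ differenceQuotient t a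
  odd⇒root-mod-2^ {t} {suc j} ¬2∣t _ with ¬2∣⇒≡1+2* t ¬2∣t
  ... | s , refl = root-mod-2^ s j

  3[p+t]≤7+pt : ∀ {p t} → 4 ≤ p → 5 ≤ t → 3 * (p + t) ≤ 7 + p * t
  3[p+t]≤7+pt {suc (suc (suc (suc p′)))} {suc (suc (suc (suc (suc t′))))}
    (s≤s (s≤s (s≤s (s≤s z≤n)))) (s≤s (s≤s (s≤s (s≤s (s≤s z≤n))))) =
    ≤-trans (m≤m+n _ (2 * p′ + t′ + p′ * t′)) (≤-reflexive (expand p′ t′))
    where
    expand : ∀ p′ t′ → 3 * (4 + p′ + (5 + t′)) + (2 * p′ + t′ + p′ * t′) ≡ 7 + (4 + p′) * (5 + t′)
    expand = solve-∀

  a+t≤n : ∀ {a p t n} → a < p → 4 ≤ p → 5 ≤ t → 2 + p * t ≤ 3 * n → a + t ≤ n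
  a+t≤n {a} {p} {t} {n} a<p 4≤p 5≤t 2+pt≤3n = s≤s⁻¹ (s<s⁻¹ (*-cancelˡ-< 3 (suc (a + t)) (2 + n) (begin-strict
    3 * suc (a + t)  ≤⟨ *-monoʳ-≤ 3 (+-monoˡ-≤ t a<p) ⟩
    3 * (p + t)      ≤⟨ 3[p+t]≤7+pt 4≤p 5≤t ⟩
    5 + (2 + p * t)  ≤⟨ +-monoʳ-≤ 5 2+pt≤3n ⟩
    5 + 3 * n        <⟨ n<1+n (5 + 3 * n) ⟩
    6 + 3 * n        ≡⟨ solve (n ∷ []) ⟩
    3 * (2 + n)      ∎)))
    where open ≤-Reasoning

open NatFacts using (differenceQuotient; cube+self-shift; odd⇒root-mod-2^; a+t≤n)

open import Defs
open import Data.Nat using (ℕ; _≤_; _<_; _*_; _^_)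
open import Data.Nat.Divisibility using () renaming (_∣_ to _∣ℕ_)
open import Data.Integer using (ℤ; +_; _+_; _-_) renaming (_^_ to _^ℤ_)
open import Data.Integer.Divisibility using (_∣_)
open import Data.Product using (∃₂; _×_)
open import Relation.Nullary using (¬_)
open import Relation.Binary.PropositionalEquality using (_≡_)

import Data.Nat as ℕ
import Data.Integer as ℤ
open import Data.Nat.Properties using (≤-trans; m≤m+n; m<m+n; m+n∸m≡n; *-comm; ^-monoʳ-≤)
open import Data.Nat.Divisibility using (*-monoˡ-∣)
open import Data.Integer.Properties using (pos-+; pos-*; m-n≡m⊖n; ⊖-≥)
open import Data.Product using (_,_)
open import Relation.Binary.PropositionalEquality
  using (refl; sym; trans; cong; cong₂; subst; module ≡-Reasoning)

pos-^ : ∀ b e → + (b ^ e) ≡ (+ b) ^ℤ e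
pos-^ b ℕ.zero    = refl
pos-^ b (ℕ.suc e) = trans (pos-* b (b ^ e)) (cong (+ b ℤ.*_) (pos-^ b e))

pos-cube+self : ∀ b → + (b ^ 3 ℕ.+ b) ≡ (+ b) ^ℤ 3 + + b
pos-cube+self b = trans (pos-+ (b ^ 3) b) (cong (_+ + b) (pos-^ b 3))

+[m+n]-+m≡+n : ∀ m n → + (m ℕ.+ n) - + m ≡ + n
+[m+n]-+m≡+n m n = trans (m-n≡m⊖n (m ℕ.+ n) m) (trans (⊖-≥ (m≤m+n m n)) (cong +_ (m+n∸m≡n m n)))

cube+self-difference : ∀ a t →
  ((+ (a ℕ.+ t)) ^ℤ 3 + + (a ℕ.+ t)) - ((+ a) ^ℤ 3 + + a) ≡ + (t * differenceQuotient t a)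
cube+self-difference a t = begin
  ((+ (a ℕ.+ t)) ^ℤ 3 + + (a ℕ.+ t)) - ((+ a) ^ℤ 3 + + a)
    ≡⟨ sym (cong₂ _-_ (pos-cube+self (a ℕ.+ t)) (pos-cube+self a)) ⟩
  + ((a ℕ.+ t) ^ 3 ℕ.+ (a ℕ.+ t)) - + (a ^ 3 ℕ.+ a)
    ≡⟨ cong (λ x → + x - + (a ^ 3 ℕ.+ a)) (cube+self-shift a t) ⟩
  + ((a ^ 3 ℕ.+ a) ℕ.+ t * differenceQuotient t a) - + (a ^ 3 ℕ.+ a)
    ≡⟨ +[m+n]-+m≡+n (a ^ 3 ℕ.+ a) (t * differenceQuotient t a) ⟩
  + (t * differenceQuotient t a) ∎
  where open ≡-Reasoning

lemma4p3 : (n k m r t : ℕ) → 1 ≤ n → IsCeilLog₃ n k →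
    n ≤ m → m < 3 ^ k → 3 ^ k < 3 * n →
    m ≡ 2 ^ r * t → 2 ≤ r → 5 ≤ t → ¬ (2 ∣ℕ t) →
    ∃₂ λ (a b : ℕ) → 1 ≤ a × a < b × b ≤ n ×
      (+ m) ∣ (((+ b) ^ℤ 3 + + b) - ((+ a) ^ℤ 3 + + a))
lemma4p3 n k m r t _ _ _ m<3ᵏ 3ᵏ<3n refl 2≤r 5≤t ¬2∣t =
  let a , 1≤a , a<2ʳ , 2ʳ∣D = odd⇒root-mod-2^ ¬2∣t (≤-trans (ℕ.s≤s ℕ.z≤n) 2≤r)
      2ʳt∣tD : 2 ^ r * t ∣ℕ t * differenceQuotient t a
      2ʳt∣tD = subst (2 ^ r * t ∣ℕ_) (*-comm (differenceQuotient t a) t) (*-monoˡ-∣ t 2ʳ∣D)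
  in a , a ℕ.+ t , 1≤a , m<m+n a (≤-trans (ℕ.s≤s ℕ.z≤n) 5≤t) ,
     a+t≤n a<2ʳ (^-monoʳ-≤ 2 2≤r) 5≤t (≤-trans (ℕ.s≤s m<3ᵏ) 3ᵏ<3n) ,
     -- ℤ-divisibility compares absolute values, so (+ m) ∣ (+ x) is m ∣ℕ x.
     subst ((+ (2 ^ r * t)) ∣_) (sym (cube+self-difference a t)) 2ʳt∣tD
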